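{- Let $\sigma=(S_0,S_1,\dots,S_L)$ with $S_0=\emptyset$ be a schedule of states in which consecutive states $S_{i-1},S_i$ are neighbours in the transition graph, and let $\sigma'=(S'_0,\dots,S'_L)$ be the schedule produced online by the algorithm Sensible-ALG on input $\sigma$. Then $\sum_{i=1}^{L} c(S'_{i-1},S'_i) \le \sum_{i=1}^{L} c(S_{i-1},S_i)$.
   Context: Let $R$ be a finite set of requests with a metric $d$. States are even-sized subsets of $R$. The transition graph $G$ has an edge between states $S,S'$ whenever $S=S'\cup\{r,r'\}$ with $r,r'\notin S'$ distinct, of cost $d(r,r')$ (a transition adding or removing $\{r,r'\}$); $c(S,S')$ is the shortest-path distance in $G$. For a transition path $P$, $\mathrm{diff}(P)$ is the multigraph on $R$ whose edge $(p,q)$ has multiplicity equal to the number of transitions along $P$ adding or removing $\{p,q\}$. For states $A,B$, an $(A,B)$-difference graph (multigraph on $R$ whose odd-degree vertices are exactly $A\triangle B$) is canonical if it decomposes into $|A\triangle B|/2$ edge-disjoint paths between disjoint pairs $(p_i,q_i)$ of $A\triangle B$, each path being the single edge $(p_i,q_i)$ when $p_i,q_i$ are both in $A\setminus B$ or both in $B\setminus A$, and being two edges $(p_i,s),(s,q_i)$ for some other request $s$ otherwise. Sensible-ALG: set $S'_0=S_0=\emptyset$. When $S_i$ arrives: if $|S_i|\le |S'_{i-1}|$, set $S'_i=S'_{i-1}$; otherwise compute a shortest transition path $P$ between $S_i$ and $S'_{i-1}$ such that $\mathrm{diff}(P)$ is canonical, and set $S'_i=S'_{i-1}\cup\{p,q\}$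 where $p,q\in S_i\setminus S'_{i-1}$ and the single edge $(p,q)$ is one of the paths in the canonical decomposition of $\mathrm{diff}(P)$.
   Formalization: The metric d on the requests takes rational values rather than real ones. -}

module Defs where

open import Data.Nat as ℕ using (ℕ; zero; suc; _<_)
open import Data.Nat.Divisibility using (_∣_)
open import Data.Bool using (Bool; true; false; _∧_; _∨_; if_then_else_)
open import Data.Fin using (Fin; _≟_)
open import Data.Fin.Subset using (Subset; _∈_; _∉_; _∪_; ∣_∣; ⁅_⁆) renaming (⊥ to ∅)
open import Data.List using (List; []; _∷_; _++_; concatMap; any)
open import Data.Product using (Σ; _×_; _,_; ∃; ∃-syntax)
open import Data.Sum using (_⊎_)
open import Data.Rational as ℚ using (ℚ; 0ℚ; _+_; _≤_)
open import Relation.Nullary using (¬_)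
open import Relation.Nullary.Decidable using (⌊_⌋)
open import Relation.Binary.PropositionalEquality using (_≡_; _≢_)

-- Requests R = Fin n with a (rational-valued) metric d.

record IsMetric {n : ℕ} (d : Fin n → Fin n → ℚ) : Set where
  field
    nonneg   : ∀ x y → 0ℚ ≤ d x y
    zero-iff : ∀ x y → d x y ≡ 0ℚ → x ≡ y
    refl0    : ∀ x → d x x ≡ 0ℚ
    symm     : ∀ x y → d x y ≡ d y x
    triangle : ∀ x y z → d x z ≤ d x y + d y z

IsState : {n : ℕ} → Subset n → Set
IsState S = 2 ∣ ∣ S ∣

Edge : {n : ℕ} → Subset n → Subset n → Fin n → Fin n → Set
Edge S T r r' =
  r ≢ r' ×
  ((r ∉ S × r' ∉ S × T ≡ S ∪ ⁅ r ⁆ ∪ ⁅ r' ⁆) ⊎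
   (r ∉ T × r' ∉ T × S ≡ T ∪ ⁅ r ⁆ ∪ ⁅ r' ⁆))

Neighbours : {n : ℕ} → Subset n → Subset n → Set
Neighbours {n} S T = ∃[ r ] ∃[ r' ] Edge S T r r'

data Path {n : ℕ} (A : Subset n) : Subset n → Set where
  []  : Path A A
  _▸_ : ∀ {B C} → Path A B → (st : Σ (Fin n) λ r → Σ (Fin n) λ r' → Edge B C r r') → Path A C

cost : {n : ℕ} → (Fin n → Fin n → ℚ) → {A B : Subset n} → Path A B → ℚ
cost d []                    = 0ℚ
cost d (P ▸ (r , r' , _))    = cost d P + d r r'

-- c(A,B) = x : x is the shortest-path distance between A and B in G.
IsDist : {n : ℕ} → (Fin n → Fin n → ℚ) → Subset n → Subset n → ℚ → Set
IsDist d A B x = (Σ (Path A B) λ P → cost d P ≡ x) × (∀ (Q : Path A B) → x ≤ cost d Q)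

-- Multigraphs on R, represented as lists of (unordered) edges; two
-- multigraphs are equal when every unordered pair has the same multiplicity.

Multigraph : ℕ → Set
Multigraph n = List (Fin n × Fin n)

mult : {n : ℕ} → Multigraph n → Fin n → Fin n → ℕ
mult []             p q = 0
mult ((a , b) ∷ G)  p q =
  if (⌊ a ≟ p ⌋ ∧ ⌊ b ≟ q ⌋) ∨ (⌊ a ≟ q ⌋ ∧ ⌊ b ≟ p ⌋)
  then suc (mult G p q) else mult G p q

_≋_ : {n : ℕ} → Multigraph n → Multigraph n → Set
G ≋ H = ∀ p q → mult G p q ≡ mult H p q

diff : {n : ℕ} {A B : Subset n} → Path A B → Multigraph n
diff []                 = []
diff (P ▸ (r , r' , _)) = (r , r') ∷ diff P

-- A piece of a decomposition: a single edge (p,q), or a two-edge path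
-- (p,s),(s,q) through some other request s.
data Piece (n : ℕ) : Set where
  single : Fin n → Fin n → Piece n
  double : Fin n → Fin n → Fin n → Piece n

pieceEdges : {n : ℕ} → Piece n → Multigraph n
pieceEdges (single p q)   = (p , q) ∷ []
pieceEdges (double p s q) = (p , s) ∷ (s , q) ∷ []

endpoints : {n : ℕ} → Piece n → List (Fin n)
endpoints (single p q)   = p ∷ q ∷ []
endpoints (double p s q) = p ∷ q ∷ []

_∈_∖_ : {n : ℕ} → Fin n → Subset n → Subset n → Set
x ∈ A ∖ B = x ∈ A × x ∉ B

ValidPiece : {n : ℕ} → Subset n → Subset n → Piece n → Set
ValidPiece A B (single p q) =
  (p ∈ A ∖ B × q ∈ A ∖ B) ⊎ (p ∈ B ∖ A × q ∈ B ∖ A)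
ValidPiece A B (double p s q) =
  s ≢ p × s ≢ q ×
  ((p ∈ A ∖ B × q ∈ B ∖ A) ⊎ (p ∈ B ∖ A × q ∈ A ∖ B))

occ : {n : ℕ} → Fin n → List (Fin n) → ℕ
occ x []       = 0
occ x (y ∷ ys) = if ⌊ x ≟ y ⌋ then suc (occ x ys) else occ x ys

_∈_△_ : {n : ℕ} → Fin n → Subset n → Subset n → Set
x ∈ A △ B = x ∈ A ∖ B ⊎ x ∈ B ∖ A

IsCanonicalDecomp : {n : ℕ} → Subset n → Subset n → List (Piece n) → Set
IsCanonicalDecomp {n} A B D =
  (∀ π → π Data.List.Membership.Propositional.∈ D → ValidPiece A B π) ×
  (∀ (x : Fin n) → (x ∈ A △ B → occ x (concatMap endpoints D) ≡ 1)
                 × (¬ (x ∈ A △ B) → occ x (concatMap endpoints D) ≡ 0))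
  where import Data.List.Membership.Propositional

DecomposesInto : {n : ℕ} → Multigraph n → List (Piece n) → Set
DecomposesInto G D = G ≋ concatMap pieceEdges D

-- One step of Sensible-ALG: given the new request state A = S_i and the
-- previous algorithm state B = S'_{i-1}, the new algorithm state B'.

SensibleStep : {n : ℕ} → (Fin n → Fin n → ℚ) → Subset n → Subset n → Subset n → Set
SensibleStep {n} d A B B' =
  (∣ A ∣ ℕ.≤ ∣ B ∣ × B' ≡ B) ⊎
  (∣ B ∣ < ∣ A ∣ ×
    Σ (Path A B) λ P →
      (∀ (Q : Path A B) → cost d P ≤ cost d Q) ×
      Σ (List (Piece n)) λ D →
        IsCanonicalDecomp A B D × DecomposesInto (diff P) D ×
        Σ (Fin n) λ p → Σ (Fin n) λ q →
          p ∈ A ∖ B × q ∈ A ∖ B ×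
          single p q Data.List.Membership.Propositional.∈ D ×
          B' ≡ B ∪ ⁅ p ⁆ ∪ ⁅ q ⁆)
  where import Data.List.Membership.Propositional

-- Schedules (indexed by ℕ; only indices 0..L are relevant).

IsSchedule : {n : ℕ} → ℕ → (ℕ → Subset n) → Set
IsSchedule L S =
  S 0 ≡ ∅ × (∀ i → i ℕ.≤ L → IsState (S i)) ×
  (∀ i → suc i ℕ.≤ L → Neighbours (S i) (S (suc i)))

-- σ' is a run of Sensible-ALG on σ (up to the choice of shortest path /
-- decomposition / pair, which the algorithm leaves open).
IsSensibleRun : {n : ℕ} → (Fin n → Fin n → ℚ) → ℕ → (ℕ → Subset n) → (ℕ → Subset n) → Set
IsSensibleRun d L S S' =
  S' 0 ≡ ∅ × (∀ i → suc i ℕ.≤ L → SensibleStep d (S (suc i)) (S' i) (S' (suc i)))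

sum1 : (ℕ → ℚ) → ℕ → ℚ
sum1 f zero    = 0ℚ
sum1 f (suc L) = sum1 f L + f (suc L)

{-# OPTIONS --safe #-}
-- Potential argument: keep a transition path ψₖ from Sₖ to S′ₖ with
--   Σ_{i≤k} c(S′ᵢ₋₁, S′ᵢ) + cost ψₖ ≤ Σ_{i≤k} c(Sᵢ₋₁, Sᵢ),
-- which gives the theorem at k = L since costs are nonnegative. If the algorithm stays, prepend the
-- reversed request move to ψₖ. If it moves to S′ₖ ∪ {p, q}, let P be its shortest path from Sₖ₊₁ to S′ₖ
-- with canonical decomposition D, so cost P ≤ c(Sₖ, Sₖ₊₁) + cost ψₖ, and cost P is the weight of D (as d is
-- symmetric, weights depend only on multiplicities). Each piece of D is realised by transitions
-- of the same total cost: a single edge by one transition, a path p–s–q by two transitions through s,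
-- ordered so that each one adds or removes a pair. Realising every piece except the edge (p, q) leads
-- from Sₖ₊₁ to S′ₖ ∪ {p, q} at cost cost P − d(p, q), while the algorithm pays at most d(p, q).
module Submission where

open import Defs
open import Algebra.Bundles using (CommutativeMonoid)
import Algebra.Properties.CommutativeSemigroup as CommutativeSemigroupProperties
open import Data.Bool using (Bool; true; false; not; T; _∧_; _∨_; if_then_else_)
open import Data.Bool.Properties using (¬-not; not-¬; not-involutive; ∨-comm; ∧-comm; ∨-identityʳ; T-≡; T-∧; T-∨)
  renaming (_≟_ to _≟ᵇ_)
open import Data.Empty using (⊥-elim)
open import Data.Fin using (Fin; _≟_)
open import Data.Fin.Subset using (Subset; _∈_; _∉_; _∪_; ⁅_⁆)
open import Data.Fin.Subset.Properties using (x∈⁅x⁆; x≢y⇒x∉⁅y⁆; x∈p∪q⁺)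
open import Data.List using (List; []; _∷_; _++_; concatMap)
open import Data.List.Properties using (concatMap-++)
open import Data.List.Membership.Propositional using () renaming (_∈_ to _∈ₗ_)
open import Data.List.Membership.Propositional.Properties using (∈-∃++; ∈-insert; ∈-++⁺ˡ; ∈-++⁺ʳ)
open import Data.List.Relation.Binary.Subset.Propositional.Properties using (++⁺ʳ; xs⊆x∷xs)
open import Data.List.Relation.Unary.Any using (here; there)
open import Data.Nat as ℕ using (ℕ; zero; suc; _≤_; z≤n; s≤s)
import Data.Nat.Properties as ℕₚ
open import Data.Product using (Σ; _×_; _,_; proj₁; proj₂)
open import Data.Rational using (ℚ; 0ℚ; _+_) renaming (_≤_ to _≤ℚ_)
import Data.Rational.Properties as ℚₚ
open import Data.Sum using (_⊎_; inj₁; inj₂; swap)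
import Data.Sum as Sum
open import Data.Vec using (lookup; tabulate; _[_]%=_)
open import Data.Vec.Properties
  using ([]=⇒lookup; lookup⇒[]=; lookup-zipWith; lookup∘updateAt; lookup∘updateAt′; tabulate∘lookup; tabulate-cong)
open import Function using (_∘_)
open import Function.Bundles using (Equivalence)
open import Relation.Binary.PropositionalEquality
open import Relation.Nullary using (¬_; yes; no)
open import Relation.Nullary.Decidable using (⌊_⌋; toWitness)

module ℕ+ = CommutativeSemigroupProperties ℕₚ.+-commutativeSemigroup
module ℚ+ = CommutativeSemigroupProperties (CommutativeMonoid.commutativeSemigroup ℚₚ.+-0-commutativeMonoid)

-- Subsets, flips and transitions

module _ {n : ℕ} where

  pair? : (x r r′ : Fin n) → (x ≡ r ⊎ x ≡ r′) ⊎ (x ≢ r × x ≢ r′)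
  pair? x r r′ with x ≟ r | x ≟ r′
  ... | yes x≡r | _         = inj₁ (inj₁ x≡r)
  ... | no _    | yes x≡r′  = inj₁ (inj₂ x≡r′)
  ... | no x≢r  | no x≢r′   = inj₂ (x≢r , x≢r′)

  pair-at : (S : Subset n) {r r′ x : Fin n} {b : Bool} →
            lookup S r ≡ b → lookup S r′ ≡ b → x ≡ r ⊎ x ≡ r′ → lookup S x ≡ b
  pair-at S Sr Sr′ (inj₁ refl) = Sr
  pair-at S Sr Sr′ (inj₂ refl) = Sr′

  lookup-ext : {S T : Subset n} → (∀ x → lookup S x ≡ lookup T x) → S ≡ T
  lookup-ext {S} {T} S≗T = begin
    S                   ≡⟨ tabulate∘lookup S ⟨
    tabulate (lookup S) ≡⟨ tabulate-cong S≗T ⟩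
    tabulate (lookup T) ≡⟨ tabulate∘lookup T ⟩
    T                   ∎
    where open ≡-Reasoning

  ∉⇒lookup≡false : {x : Fin n} {S : Subset n} → x ∉ S → lookup S x ≡ false
  ∉⇒lookup≡false {x} {S} x∉S with lookup S x in Sx
  ... | true  = ⊥-elim (x∉S (lookup⇒[]= x S Sx))
  ... | false = refl

  lookup≡false⇒∉ : {x : Fin n} {S : Subset n} → lookup S x ≡ false → x ∉ S
  lookup≡false⇒∉ Sx≡false x∈S with trans (sym Sx≡false) ([]=⇒lookup x∈S)
  ... | ()

  lookup≡not⇒≢ : {S : Subset n} {x y : Fin n} → lookup S x ≡ not (lookup S y) → x ≢ y
  lookup≡not⇒≢ Sx≡¬Sy refl = not-¬ refl Sx≡¬Sy

  lookup-∪-pair-hit : (S : Subset n) {r r′ x : Fin n} → x ≡ r ⊎ x ≡ r′ → lookup (S ∪ ⁅ r ⁆ ∪ ⁅ r′ ⁆) x ≡ true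
  lookup-∪-pair-hit S {r} {r′} end =
    []=⇒lookup (x∈p∪q⁺ {p = S} (inj₂ (x∈p∪q⁺ {p = ⁅ r ⁆} {q = ⁅ r′ ⁆} (in-pair end))))
    where
    in-pair : ∀ {x} → x ≡ r ⊎ x ≡ r′ → x ∈ ⁅ r ⁆ ⊎ x ∈ ⁅ r′ ⁆
    in-pair (inj₁ refl) = inj₁ (x∈⁅x⁆ r)
    in-pair (inj₂ refl) = inj₂ (x∈⁅x⁆ r′)

  lookup-∪-pair-miss : (S : Subset n) {r r′ x : Fin n} → x ≢ r → x ≢ r′ →
                       lookup (S ∪ ⁅ r ⁆ ∪ ⁅ r′ ⁆) x ≡ lookup S x
  lookup-∪-pair-miss S {r} {r′} {x} x≢r x≢r′ = begin
    lookup (S ∪ ⁅ r ⁆ ∪ ⁅ r′ ⁆) x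
      ≡⟨ lookup-zipWith _∨_ x S _ ⟩
    lookup S x ∨ lookup (⁅ r ⁆ ∪ ⁅ r′ ⁆) x
      ≡⟨ cong (lookup S x ∨_) (lookup-zipWith _∨_ x ⁅ r ⁆ ⁅ r′ ⁆) ⟩
    lookup S x ∨ (lookup ⁅ r ⁆ x ∨ lookup ⁅ r′ ⁆ x)
      ≡⟨ cong₂ (λ u v → lookup S x ∨ (u ∨ v)) (outside x≢r) (outside x≢r′) ⟩
    lookup S x ∨ false
      ≡⟨ ∨-identityʳ _ ⟩
    lookup S x
      ∎
    where
    open ≡-Reasoning
    outside : {y : Fin n} → x ≢ y → lookup ⁅ y ⁆ x ≡ false
    outside = ∉⇒lookup≡false ∘ x≢y⇒x∉⁅y⁆

  ≡-∪-pair : {S T : Subset n} {r r′ : Fin n} → (∀ {x} → x ≡ r ⊎ x ≡ r′ → lookup S x ≡ true) →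
             (∀ {x} → x ≢ r → x ≢ r′ → lookup S x ≡ lookup T x) → S ≡ T ∪ ⁅ r ⁆ ∪ ⁅ r′ ⁆
  ≡-∪-pair {S} {T} {r} {r′} S-at S-off = lookup-ext pointwise
    where
    pointwise : ∀ x → lookup S x ≡ lookup (T ∪ ⁅ r ⁆ ∪ ⁅ r′ ⁆) x
    pointwise x with pair? x r r′
    ... | inj₁ end           = trans (S-at end) (sym (lookup-∪-pair-hit T end))
    ... | inj₂ (x≢r , x≢r′)  = trans (S-off x≢r x≢r′) (sym (lookup-∪-pair-miss T x≢r x≢r′))

  record Flips (S T : Subset n) (r r′ : Fin n) : Set where
    field
      flipped : ∀ {x} → x ≡ r ⊎ x ≡ r′ → lookup T x ≡ not (lookup S x)
      kept    : ∀ {x} → x ≢ r → x ≢ r′ → lookup T x ≡ lookup S x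

  open Flips public

  flipped-pair : {S T : Subset n} {r r′ x : Fin n} {b : Bool} → Flips S T r r′ →
                 lookup S r ≡ b → lookup S r′ ≡ b → x ≡ r ⊎ x ≡ r′ → lookup T x ≡ not b
  flipped-pair {S} F Sr Sr′ end = trans (flipped F end) (cong not (pair-at S Sr Sr′ end))

  flips⇒edge : {S T : Subset n} {r r′ : Fin n} (b : Bool) → r ≢ r′ →
               lookup S r ≡ b → lookup S r′ ≡ b → Flips S T r r′ → Edge S T r r′
  flips⇒edge {S} true r≢r′ Sr Sr′ F =
    r≢r′ , inj₂ ( lookup≡false⇒∉ (flipped-pair F Sr Sr′ (inj₁ refl))
                , lookup≡false⇒∉ (flipped-pair F Sr Sr′ (inj₂ refl))
                , ≡-∪-pair (pair-at S Sr Sr′) (λ x≢r x≢r′ → sym (kept F x≢r x≢r′)) )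
  flips⇒edge false r≢r′ Sr Sr′ F =
    r≢r′ , inj₁ (lookup≡false⇒∉ Sr , lookup≡false⇒∉ Sr′ , ≡-∪-pair (flipped-pair F Sr Sr′) (kept F))

  ∪-pair-flips : {S : Subset n} {r r′ : Fin n} → r ∉ S → r′ ∉ S → Flips S (S ∪ ⁅ r ⁆ ∪ ⁅ r′ ⁆) r r′
  ∪-pair-flips {S} r∉S r′∉S = record
    { flipped = λ end → trans (lookup-∪-pair-hit S end)
                              (cong not (sym (pair-at S (∉⇒lookup≡false r∉S) (∉⇒lookup≡false r′∉S) end)))
    ; kept    = lookup-∪-pair-miss S
    }

  flip-pair : Subset n → Fin n → Fin n → Subset n
  flip-pair S r r′ = S [ r ]%= not [ r′ ]%= not

  flip-pair-flips : (S : Subset n) {r r′ : Fin n} → r ≢ r′ → Flips S (flip-pair S r r′) r r′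
  flip-pair-flips S {r} {r′} r≢r′ = record { flipped = flipped′ ; kept = kept′ }
    where
    flipped′ : ∀ {x} → x ≡ r ⊎ x ≡ r′ → lookup (flip-pair S r r′) x ≡ not (lookup S x)
    flipped′ (inj₁ refl) = trans (lookup∘updateAt′ r r′ r≢r′ (S [ r ]%= not)) (lookup∘updateAt r S)
    flipped′ (inj₂ refl) =
      trans (lookup∘updateAt r′ (S [ r ]%= not)) (cong not (lookup∘updateAt′ r′ r (r≢r′ ∘ sym) S))
    kept′ : ∀ {x} → x ≢ r → x ≢ r′ → lookup (flip-pair S r r′) x ≡ lookup S x
    kept′ {x} x≢r x≢r′ = trans (lookup∘updateAt′ x r′ x≢r′ (S [ r ]%= not)) (lookup∘updateAt′ x r x≢r S)

  flips-swap : {S T : Subset n} {r r′ : Fin n} → Flips S T r r′ → Flips S T r′ r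
  flips-swap F = record { flipped = flipped F ∘ swap ; kept = λ x≢r′ x≢r → kept F x≢r x≢r′ }

  flips-trans : {A X Y : Subset n} {p s q : Fin n} → s ≢ p → s ≢ q → q ≢ p →
                Flips A X p s → Flips X Y s q → Flips A Y p q
  flips-trans {A} {X} {Y} {p} {s} {q} s≢p s≢q q≢p F G = record { flipped = flipped′ ; kept = kept′ }
    where
    flipped′ : ∀ {x} → x ≡ p ⊎ x ≡ q → lookup Y x ≡ not (lookup A x)
    flipped′ (inj₁ refl) = trans (kept G (s≢p ∘ sym) (q≢p ∘ sym)) (flipped F (inj₁ refl))
    flipped′ (inj₂ refl) = trans (flipped G (inj₂ refl)) (cong not (kept F q≢p (s≢q ∘ sym)))
    kept′ : ∀ {x} → x ≢ p → x ≢ q → lookup Y x ≡ lookup A x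
    kept′ {x} x≢p x≢q with x ≟ s
    ... | yes refl = trans (flipped G (inj₁ refl))
                           (trans (cong not (flipped F (inj₂ refl))) (not-involutive _))
    ... | no x≢s   = trans (kept G x≢s x≢q) (kept F x≢p x≢s)

-- Pieces, paths and costs

module _ {n : ℕ} where

  end₁ end₂ : Piece n → Fin n
  end₁ (single p _)   = p
  end₁ (double p _ _) = p
  end₂ (single _ q)   = q
  end₂ (double _ _ q) = q

  IsEnd : Fin n → Piece n → Set
  IsEnd x π = x ≡ end₁ π ⊎ x ≡ end₂ π

  ends : List (Piece n) → List (Fin n)
  ends = concatMap endpoints

  edges : List (Piece n) → Multigraph n
  edges = concatMap pieceEdges

  infixr 5 _++ᴾ_

  _++ᴾ_ : {A B C : Subset n} → Path A B → Path B C → Path A C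
  P ++ᴾ []      = P
  P ++ᴾ (Q ▸ e) = (P ++ᴾ Q) ▸ e

  edge-sym : {S T : Subset n} {r r′ : Fin n} → Edge S T r r′ → Edge T S r r′
  edge-sym (r≢r′ , inj₁ adding)   = r≢r′ , inj₂ adding
  edge-sym (r≢r′ , inj₂ removing) = r≢r′ , inj₁ removing

  reverseᴾ : {A B : Subset n} → Path A B → Path B A
  reverseᴾ []                 = []
  reverseᴾ (P ▸ (r , r′ , e)) = ([] ▸ (r , r′ , edge-sym e)) ++ᴾ reverseᴾ P

module _ {n : ℕ} (d : Fin n → Fin n → ℚ) where

  cost-++ᴾ : {A B C : Subset n} (P : Path A B) (Q : Path B C) → cost d (P ++ᴾ Q) ≡ cost d P + cost d Q
  cost-++ᴾ P []                 = sym (ℚₚ.+-identityʳ _)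
  cost-++ᴾ P (Q ▸ (r , r′ , _)) = trans (cong (_+ d r r′) (cost-++ᴾ P Q)) (ℚₚ.+-assoc (cost d P) _ _)

  cost-reverseᴾ : {A B : Subset n} (P : Path A B) → cost d (reverseᴾ P) ≡ cost d P
  cost-reverseᴾ []                     = refl
  cost-reverseᴾ (P ▸ (r , r′ , e)) = begin
    cost d (([] ▸ (r , r′ , edge-sym e)) ++ᴾ reverseᴾ P) ≡⟨ cost-++ᴾ ([] ▸ (r , r′ , edge-sym e)) (reverseᴾ P) ⟩
    (0ℚ + d r r′) + cost d (reverseᴾ P)                  ≡⟨ cong₂ _+_ (ℚₚ.+-identityˡ (d r r′)) (cost-reverseᴾ P) ⟩
    d r r′ + cost d P                                     ≡⟨ ℚₚ.+-comm (d r r′) _ ⟩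
    cost d P + d r r′                                     ∎
    where open ≡-Reasoning

  cost-subst : {A B C : Subset n} (B≡C : B ≡ C) (P : Path A B) → cost d (subst (Path A) B≡C P) ≡ cost d P
  cost-subst refl P = refl

  cost-nonneg : (∀ x y → 0ℚ ≤ℚ d x y) → {A B : Subset n} (P : Path A B) → 0ℚ ≤ℚ cost d P
  cost-nonneg d≥0 []                 = ℚₚ.≤-refl
  cost-nonneg d≥0 (P ▸ (r , r′ , _)) = ℚₚ.+-mono-≤ (cost-nonneg d≥0 P) (d≥0 r r′)

  weight : Multigraph n → ℚ
  weight []             = 0ℚ
  weight ((a , b) ∷ G) = d a b + weight G

  weight-++ : (G H : Multigraph n) → weight (G ++ H) ≡ weight G + weight H
  weight-++ []             H = sym (ℚₚ.+-identityˡ _)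
  weight-++ ((a , b) ∷ G) H = trans (cong (d a b +_) (weight-++ G H)) (sym (ℚₚ.+-assoc (d a b) _ _))

  weight-edges-++-∷ : (D₁ : List (Piece n)) (π : Piece n) (D₂ : List (Piece n)) →
                      weight (edges (D₁ ++ π ∷ D₂)) ≡ weight (pieceEdges π) + weight (edges (D₁ ++ D₂))
  weight-edges-++-∷ D₁ π D₂ = begin
    weight (edges (D₁ ++ π ∷ D₂))                ≡⟨ cong weight (concatMap-++ pieceEdges D₁ (π ∷ D₂)) ⟩
    weight (edges D₁ ++ pieceEdges π ++ edges D₂) ≡⟨ weight-++ (edges D₁) _ ⟩
    w₁ + weight (pieceEdges π ++ edges D₂)        ≡⟨ cong (w₁ +_) (weight-++ (pieceEdges π) _) ⟩
    w₁ + (w + w₂)                                 ≡⟨ ℚ+.x∙yz≈y∙xz w₁ w w₂ ⟩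
    w + (w₁ + w₂)                                 ≡⟨ cong (w +_) (weight-++ (edges D₁) _) ⟨
    w + weight (edges D₁ ++ edges D₂)             ≡⟨ cong (λ G → w + weight G) (concatMap-++ pieceEdges D₁ D₂) ⟨
    w + weight (edges (D₁ ++ D₂))                 ∎
    where
    open ≡-Reasoning
    w w₁ w₂ : ℚ
    w  = weight (pieceEdges π)
    w₁ = weight (edges D₁)
    w₂ = weight (edges D₂)

  cost≡weight-diff : {A B : Subset n} (P : Path A B) → cost d P ≡ weight (diff P)
  cost≡weight-diff []                 = refl
  cost≡weight-diff (P ▸ (r , r′ , _)) = trans (ℚₚ.+-comm (cost d P) _) (cong (d r r′ +_) (cost≡weight-diff P))

module _ {n : ℕ} where

  joins : Fin n → Fin n → Fin n → Fin n → Bool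
  joins a b p q = (⌊ a ≟ p ⌋ ∧ ⌊ b ≟ q ⌋) ∨ (⌊ a ≟ q ⌋ ∧ ⌊ b ≟ p ⌋)

  joins-true : {a b p q : Fin n} → joins a b p q ≡ true → (a ≡ p × b ≡ q) ⊎ (a ≡ q × b ≡ p)
  joins-true {a} {b} {p} {q} test =
    Sum.map witnesses witnesses (Equivalence.to (T-∨ {⌊ a ≟ p ⌋ ∧ ⌊ b ≟ q ⌋}) (Equivalence.from T-≡ test))
    where
    witnesses : {x y u v : Fin n} → T (⌊ x ≟ y ⌋ ∧ ⌊ u ≟ v ⌋) → x ≡ y × u ≡ v
    witnesses {x} {y} t with Equivalence.to (T-∧ {⌊ x ≟ y ⌋}) t
    ... | tx , tu = toWitness tx , toWitness tu

  mult-∷-self : (a b : Fin n) (G : Multigraph n) → mult ((a , b) ∷ G) a b ≡ suc (mult G a b)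
  mult-∷-self a b G with a ≟ a | b ≟ b
  ... | yes _   | yes _   = refl
  ... | no a≢a  | _       = ⊥-elim (a≢a refl)
  ... | yes _   | no b≢b  = ⊥-elim (b≢b refl)

  ∷-cong-≋ : (a b : Fin n) (G H : Multigraph n) → G ≋ H → ((a , b) ∷ G) ≋ ((a , b) ∷ H)
  ∷-cong-≋ a b G H G≋H p q with joins a b p q
  ... | true  = cong suc (G≋H p q)
  ... | false = G≋H p q

  ≋-∷-cancel : (a b : Fin n) (G H : Multigraph n) → ((a , b) ∷ G) ≋ ((a , b) ∷ H) → G ≋ H
  ≋-∷-cancel a b G H ∷G≋∷H p q with joins a b p q | ∷G≋∷H p q
  ... | true  | eq = ℕₚ.suc-injective eq
  ... | false | eq = eq

  ≋-flip-head : (a b : Fin n) (G : Multigraph n) → ((a , b) ∷ G) ≋ ((b , a) ∷ G)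
  ≋-flip-head a b G p q =
    cong (λ t → if t then suc (mult G p q) else mult G p q)
         (trans (∨-comm (⌊ a ≟ p ⌋ ∧ ⌊ b ≟ q ⌋) _) (cong₂ _∨_ (∧-comm ⌊ a ≟ q ⌋ _) (∧-comm ⌊ a ≟ p ⌋ _)))

  ≋-swap-heads : (e f : Fin n × Fin n) (G : Multigraph n) → (e ∷ f ∷ G) ≋ (f ∷ e ∷ G)
  ≋-swap-heads (a , b) (c , e) G p q with joins a b p q | joins c e p q
  ... | true  | true  = refl
  ... | true  | false = refl
  ... | false | true  = refl
  ... | false | false = refl

module _ {n : ℕ} (d : Fin n → Fin n → ℚ) (d-sym : ∀ x y → d x y ≡ d y x) where

  extract-edge : (H : Multigraph n) (a b : Fin n) → 1 ≤ mult H a b →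
                 Σ (Multigraph n) λ H′ → H ≋ ((a , b) ∷ H′) × weight d H ≡ d a b + weight d H′
  extract-edge ((c , e) ∷ H) a b pos with joins c e a b in test
  ... | true with joins-true {a = c} {b = e} {p = a} {q = b} test
  ...   | inj₁ (refl , refl) = H , (λ p q → refl) , refl
  ...   | inj₂ (refl , refl) = H , ≋-flip-head c e H , cong (_+ weight d H) (d-sym c e)
  extract-edge ((c , e) ∷ H) a b pos | false with extract-edge H a b pos
  ... | H′ , H≋ , weight-H =
    (c , e) ∷ H′ , ∷H≋ , trans (cong (d c e +_) weight-H) (ℚ+.x∙yz≈y∙xz (d c e) (d a b) (weight d H′))
    where
    ∷H≋ : ((c , e) ∷ H) ≋ ((a , b) ∷ (c , e) ∷ H′)
    ∷H≋ p q = trans (∷-cong-≋ c e H ((a , b) ∷ H′) H≋ p q) (≋-swap-heads (c , e) (a , b) H′ p q)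

  ≋⇒weight≡ : (G H : Multigraph n) → G ≋ H → weight d G ≡ weight d H
  ≋⇒weight≡ [] []              _   = refl
  ≋⇒weight≡ [] ((a , b) ∷ H)   []≋ with trans ([]≋ a b) (mult-∷-self a b H)
  ... | ()
  ≋⇒weight≡ ((a , b) ∷ G) H    G≋H
    with extract-edge H a b (subst (1 ≤_) (trans (sym (mult-∷-self a b G)) (G≋H a b)) (s≤s z≤n))
  ... | H′ , H≋ , weight-H = trans (cong (d a b +_) (≋⇒weight≡ G H′ G≋H′)) (sym weight-H)
    where
    G≋H′ : G ≋ H′
    G≋H′ = ≋-∷-cancel a b G H′ (λ p q → trans (G≋H p q) (H≋ p q))

-- Canonical decompositions

module _ {n : ℕ} where

  occ-++ : (x : Fin n) (xs ys : List (Fin n)) → occ x (xs ++ ys) ≡ occ x xs ℕ.+ occ x ys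
  occ-++ x []       ys = refl
  occ-++ x (y ∷ xs) ys with x ≟ y
  ... | yes _ = cong suc (occ-++ x xs ys)
  ... | no _  = occ-++ x xs ys

  occ-∷-≢ : {x y : Fin n} {xs : List (Fin n)} → x ≢ y → occ x (y ∷ xs) ≡ occ x xs
  occ-∷-≢ {x} {y} x≢y with x ≟ y
  ... | yes x≡y = ⊥-elim (x≢y x≡y)
  ... | no _    = refl

  ∈⇒occ≥1 : {x : Fin n} {xs : List (Fin n)} → x ∈ₗ xs → 1 ≤ occ x xs
  ∈⇒occ≥1 {x} {y ∷ xs} x∈ with x ≟ y | x∈
  ... | yes _  | _          = s≤s z≤n
  ... | no x≢y | here x≡y   = ⊥-elim (x≢y x≡y)
  ... | no _   | there x∈xs = ∈⇒occ≥1 x∈xs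

  occ-loop : (p : Fin n) → occ p (p ∷ p ∷ []) ≡ 2
  occ-loop p with p ≟ p
  ... | yes _  = refl
  ... | no p≢p = ⊥-elim (p≢p refl)

  end∈endpoints : {x : Fin n} (π : Piece n) → IsEnd x π → x ∈ₗ endpoints π
  end∈endpoints (single _ _)   (inj₁ x≡p) = here x≡p
  end∈endpoints (single _ _)   (inj₂ x≡q) = there (here x≡q)
  end∈endpoints (double _ _ _) (inj₁ x≡p) = here x≡p
  end∈endpoints (double _ _ _) (inj₂ x≡q) = there (here x≡q)

  end∈ends : {x : Fin n} {π : Piece n} {D : List (Piece n)} → π ∈ₗ D → IsEnd x π → x ∈ₗ ends D
  end∈ends {π = π}            (here refl)  end = ∈-++⁺ˡ (end∈endpoints π end)
  end∈ends {D = π′ ∷ _}      (there π∈D)  end = ∈-++⁺ʳ (endpoints π′) (end∈ends π∈D end)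

  occ-endpoints-off : {x : Fin n} (π : Piece n) → x ≢ end₁ π → x ≢ end₂ π → occ x (endpoints π) ≡ 0
  occ-endpoints-off (single _ q)   x≢p x≢q = trans (occ-∷-≢ {xs = q ∷ []} x≢p) (occ-∷-≢ {xs = []} x≢q)
  occ-endpoints-off (double _ _ q) x≢p x≢q = trans (occ-∷-≢ {xs = q ∷ []} x≢p) (occ-∷-≢ {xs = []} x≢q)

  occ-endpoints-loop : (π : Piece n) → end₁ π ≡ end₂ π → occ (end₁ π) (endpoints π) ≡ 2
  occ-endpoints-loop (single p _)   refl = occ-loop p
  occ-endpoints-loop (double p _ _) refl = occ-loop p

  occ-ends-++-∷ : (x : Fin n) (D₁ : List (Piece n)) (π : Piece n) (D₂ : List (Piece n)) →
                  occ x (ends (D₁ ++ π ∷ D₂)) ≡ occ x (endpoints π) ℕ.+ occ x (ends (D₁ ++ D₂))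
  occ-ends-++-∷ x D₁ π D₂ = begin
    occ x (ends (D₁ ++ π ∷ D₂))                ≡⟨ cong (occ x) (concatMap-++ endpoints D₁ (π ∷ D₂)) ⟩
    occ x (ends D₁ ++ endpoints π ++ ends D₂)  ≡⟨ occ-++ x (ends D₁) _ ⟩
    k₁ ℕ.+ occ x (endpoints π ++ ends D₂)      ≡⟨ cong (k₁ ℕ.+_) (occ-++ x (endpoints π) _) ⟩
    k₁ ℕ.+ (k ℕ.+ k₂)                          ≡⟨ ℕ+.x∙yz≈y∙xz k₁ k k₂ ⟩
    k ℕ.+ (k₁ ℕ.+ k₂)                          ≡⟨ cong (k ℕ.+_) (occ-++ x (ends D₁) _) ⟨
    k ℕ.+ occ x (ends D₁ ++ ends D₂)           ≡⟨ cong (λ xs → k ℕ.+ occ x xs) (concatMap-++ endpoints D₁ D₂) ⟨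
    k ℕ.+ occ x (ends (D₁ ++ D₂))              ∎
    where
    open ≡-Reasoning
    k k₁ k₂ : ℕ
    k  = occ x (endpoints π)
    k₁ = occ x (ends D₁)
    k₂ = occ x (ends D₂)

  occ-ends-off : {x : Fin n} (D₁ : List (Piece n)) (π : Piece n) (D₂ : List (Piece n)) → x ≢ end₁ π → x ≢ end₂ π →
                 occ x (ends (D₁ ++ D₂)) ≡ occ x (ends (D₁ ++ π ∷ D₂))
  occ-ends-off {x} D₁ π D₂ x≢a x≢b =
    sym (trans (occ-ends-++-∷ x D₁ π D₂) (cong (ℕ._+ occ x (ends (D₁ ++ D₂))) (occ-endpoints-off π x≢a x≢b)))

  ∈∖-respˡ : {A B T : Subset n} {x : Fin n} → lookup T x ≡ lookup A x → x ∈ A ∖ B → x ∈ T ∖ B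
  ∈∖-respˡ {T = T} {x} Tx≡Ax (x∈A , x∉B) = lookup⇒[]= x T (trans Tx≡Ax ([]=⇒lookup x∈A)) , x∉B

  ∈∖-respʳ : {A B T : Subset n} {x : Fin n} → lookup T x ≡ lookup A x → x ∈ B ∖ A → x ∈ B ∖ T
  ∈∖-respʳ Tx≡Ax (x∈B , x∉A) = x∈B , lookup≡false⇒∉ (trans Tx≡Ax (∉⇒lookup≡false x∉A))

  validPiece-resp : {A B T : Subset n} (π : Piece n) →
                    lookup T (end₁ π) ≡ lookup A (end₁ π) → lookup T (end₂ π) ≡ lookup A (end₂ π) →
                    ValidPiece A B π → ValidPiece T B π
  validPiece-resp (single _ _)   Tp Tq (inj₁ (p∈ , q∈)) = inj₁ (∈∖-respˡ Tp p∈ , ∈∖-respˡ Tq q∈)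
  validPiece-resp (single _ _)   Tp Tq (inj₂ (p∈ , q∈)) = inj₂ (∈∖-respʳ Tp p∈ , ∈∖-respʳ Tq q∈)
  validPiece-resp (double _ _ _) Tp Tq (s≢p , s≢q , inj₁ (p∈ , q∈)) =
    s≢p , s≢q , inj₁ (∈∖-respˡ Tp p∈ , ∈∖-respʳ Tq q∈)
  validPiece-resp (double _ _ _) Tp Tq (s≢p , s≢q , inj₂ (p∈ , q∈)) =
    s≢p , s≢q , inj₂ (∈∖-respʳ Tp p∈ , ∈∖-respˡ Tq q∈)

  validPiece-sym : {A B : Subset n} (π : Piece n) → ValidPiece A B π → ValidPiece B A π
  validPiece-sym (single _ _)   (inj₁ v)               = inj₂ v
  validPiece-sym (single _ _)   (inj₂ v)               = inj₁ v
  validPiece-sym (double _ _ _) (s≢p , s≢q , inj₁ v) = s≢p , s≢q , inj₂ v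
  validPiece-sym (double _ _ _) (s≢p , s≢q , inj₂ v) = s≢p , s≢q , inj₁ v

  -- IsCanonicalDecomp with x ∈ A △ B read as lookup A x ≢ lookup B x.
  record Canonical (A B : Subset n) (D : List (Piece n)) : Set where
    field
      valid : ∀ {π} → π ∈ₗ D → ValidPiece A B π
      occ-≢ : ∀ {x} → lookup A x ≢ lookup B x → occ x (ends D) ≡ 1
      occ-≡ : ∀ {x} → lookup A x ≡ lookup B x → occ x (ends D) ≡ 0

  open Canonical public

  isCanonicalDecomp⇒canonical : {A B : Subset n} {D : List (Piece n)} →
                                IsCanonicalDecomp A B D → Canonical A B D
  isCanonicalDecomp⇒canonical {A} {B} (valid′ , occs) = record
    { valid = λ {π} → valid′ π
    ; occ-≢ = λ {x} Ax≢Bx → proj₁ (occs x) (≢⇒∈△ Ax≢Bx)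
    ; occ-≡ = λ {x} Ax≡Bx → proj₂ (occs x) (≡⇒∉△ Ax≡Bx)
    }
    where
    ≢⇒∈△ : {x : Fin n} → lookup A x ≢ lookup B x → x ∈ A △ B
    ≢⇒∈△ {x} Ax≢Bx with lookup A x in Ax | lookup B x in Bx
    ... | true  | true  = ⊥-elim (Ax≢Bx refl)
    ... | true  | false = inj₁ (lookup⇒[]= x A Ax , lookup≡false⇒∉ Bx)
    ... | false | true  = inj₂ (lookup⇒[]= x B Bx , lookup≡false⇒∉ Ax)
    ... | false | false = ⊥-elim (Ax≢Bx refl)
    ≡⇒∉△ : {x : Fin n} → lookup A x ≡ lookup B x → ¬ (x ∈ A △ B)
    ≡⇒∉△ {x} Ax≡Bx (inj₁ (x∈A , x∉B)) = x∉B (lookup⇒[]= x B (trans (sym Ax≡Bx) ([]=⇒lookup x∈A)))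
    ≡⇒∉△ {x} Ax≡Bx (inj₂ (x∈B , x∉A)) = x∉A (lookup⇒[]= x A (trans Ax≡Bx ([]=⇒lookup x∈B)))

  canonical-sym : {A B : Subset n} {D : List (Piece n)} → Canonical A B D → Canonical B A D
  canonical-sym C = record
    { valid = λ {π} π∈D → validPiece-sym π (valid C π∈D)
    ; occ-≢ = λ Bx≢Ax → occ-≢ C (Bx≢Ax ∘ sym)
    ; occ-≡ = occ-≡ C ∘ sym
    }

  canonical-occ≤1 : {A B : Subset n} {D : List (Piece n)} → Canonical A B D → (x : Fin n) → occ x (ends D) ≤ 1
  canonical-occ≤1 {A} {B} C x with lookup A x ≟ᵇ lookup B x
  ... | yes Ax≡Bx = subst (_≤ 1) (sym (occ-≡ C Ax≡Bx)) z≤n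
  ... | no Ax≢Bx  = subst (_≤ 1) (sym (occ-≢ C Ax≢Bx)) ℕₚ.≤-refl

  canonical-distinct-ends : {A B : Subset n} {D : List (Piece n)} {π : Piece n} →
                            Canonical A B D → π ∈ₗ D → end₁ π ≢ end₂ π
  canonical-distinct-ends {π = π} C π∈D loop with ∈-∃++ π∈D
  ... | D₁ , D₂ , refl = ℕₚ.1+n≰n (begin
    2                                                   ≡⟨ occ-endpoints-loop π loop ⟨
    occ (end₁ π) (endpoints π)                          ≤⟨ ℕₚ.m≤m+n _ _ ⟩
    occ (end₁ π) (endpoints π) ℕ.+ occ (end₁ π) (ends (D₁ ++ D₂)) ≡⟨ occ-ends-++-∷ (end₁ π) D₁ π D₂ ⟨
    occ (end₁ π) (ends (D₁ ++ π ∷ D₂))                  ≤⟨ canonical-occ≤1 C (end₁ π) ⟩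
    1                                                   ∎)
    where open ℕₚ.≤-Reasoning

  canonical-occ-end : {A B : Subset n} (D₁ : List (Piece n)) (π : Piece n) (D₂ : List (Piece n)) →
                      Canonical A B (D₁ ++ π ∷ D₂) → {x : Fin n} → IsEnd x π → occ x (ends (D₁ ++ D₂)) ≡ 0
  canonical-occ-end D₁ π D₂ C {x} end = ℕₚ.n≤0⇒n≡0 (ℕₚ.+-cancelˡ-≤ 1 _ 0 (begin
    1 ℕ.+ occ x (ends (D₁ ++ D₂))                         ≤⟨ ℕₚ.+-monoˡ-≤ _ (∈⇒occ≥1 (end∈endpoints π end)) ⟩
    occ x (endpoints π) ℕ.+ occ x (ends (D₁ ++ D₂))       ≡⟨ occ-ends-++-∷ x D₁ π D₂ ⟨
    occ x (ends (D₁ ++ π ∷ D₂))                           ≤⟨ canonical-occ≤1 C x ⟩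
    1                                                     ∎))
    where open ℕₚ.≤-Reasoning

  canonical-end-differs : {A B : Subset n} {D : List (Piece n)} {π : Piece n} {x : Fin n} →
                          Canonical A B D → π ∈ₗ D → IsEnd x π → lookup A x ≢ lookup B x
  canonical-end-differs C π∈D end Ax≡Bx
    with subst (1 ≤_) (occ-≡ C Ax≡Bx) (∈⇒occ≥1 (end∈ends π∈D end))
  ... | ()

  canonical-[]⇒≡ : {A B : Subset n} → Canonical A B [] → A ≡ B
  canonical-[]⇒≡ {A} {B} C = lookup-ext agree
    where
    agree : ∀ x → lookup A x ≡ lookup B x
    agree x with lookup A x ≟ᵇ lookup B x
    ... | yes Ax≡Bx = Ax≡Bx
    ... | no Ax≢Bx with occ-≢ C Ax≢Bx
    ...   | ()

  canonical-remove : {A B T : Subset n} (D₁ : List (Piece n)) (π : Piece n) (D₂ : List (Piece n)) →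
                     Canonical A B (D₁ ++ π ∷ D₂) → Flips A T (end₁ π) (end₂ π) → Canonical T B (D₁ ++ D₂)
  canonical-remove {A} {B} {T} D₁ π D₂ C F = record { valid = valid′ ; occ-≢ = occ-≢′ ; occ-≡ = occ-≡′ }
    where
    settled : ∀ {x} → IsEnd x π → lookup T x ≡ lookup B x
    settled end = trans (flipped F end)
                        (sym (¬-not (canonical-end-differs C (∈-insert D₁) end ∘ sym)))

    occ-≢′ : ∀ {x} → lookup T x ≢ lookup B x → occ x (ends (D₁ ++ D₂)) ≡ 1
    occ-≢′ {x} Tx≢Bx with pair? x (end₁ π) (end₂ π)
    ... | inj₁ end          = ⊥-elim (Tx≢Bx (settled end))
    ... | inj₂ (x≢a , x≢b)  = trans (occ-ends-off D₁ π D₂ x≢a x≢b) (occ-≢ C (Tx≢Bx ∘ trans (kept F x≢a x≢b)))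

    occ-≡′ : ∀ {x} → lookup T x ≡ lookup B x → occ x (ends (D₁ ++ D₂)) ≡ 0
    occ-≡′ {x} Tx≡Bx with pair? x (end₁ π) (end₂ π)
    ... | inj₁ end          = canonical-occ-end D₁ π D₂ C end
    ... | inj₂ (x≢a , x≢b)  = trans (occ-ends-off D₁ π D₂ x≢a x≢b) (occ-≡ C (trans (sym (kept F x≢a x≢b)) Tx≡Bx))

    untouched : ∀ {π′ x} → π′ ∈ₗ D₁ ++ D₂ → IsEnd x π′ → lookup T x ≡ lookup A x
    untouched {x = x} π′∈ end′ with pair? x (end₁ π) (end₂ π)
    ... | inj₁ end with subst (1 ≤_) (canonical-occ-end D₁ π D₂ C end) (∈⇒occ≥1 (end∈ends π′∈ end′))
    ...   | ()
    untouched π′∈ end′ | inj₂ (x≢a , x≢b) = kept F x≢a x≢b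

    valid′ : ∀ {π′} → π′ ∈ₗ D₁ ++ D₂ → ValidPiece T B π′
    valid′ {π′} π′∈ = validPiece-resp π′ (untouched π′∈ (inj₁ refl)) (untouched π′∈ (inj₂ refl))
                                          (valid C (++⁺ʳ D₁ (xs⊆x∷xs D₂ π) π′∈))

-- Realising canonical decompositions by transitions

module _ {n : ℕ} (d : Fin n → Fin n → ℚ) where

  record FlipPath (A : Subset n) (r r′ : Fin n) (w : ℚ) : Set where
    field
      target : Subset n
      flips  : Flips A target r r′
      path   : Path A target
      cost≡  : cost d path ≡ w

  open FlipPath

  flipPath-swap : {A : Subset n} {r r′ : Fin n} {w : ℚ} → FlipPath A r r′ w → FlipPath A r′ r w
  flipPath-swap F = record { FlipPath F ; flips = flips-swap (flips F) }

  flipPath-trans : {A : Subset n} {p s q : Fin n} {w₁ w₂ : ℚ} → s ≢ p → s ≢ q → q ≢ p →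
                   (F : FlipPath A p s w₁) → FlipPath (target F) s q w₂ → FlipPath A p q (w₁ + w₂)
  flipPath-trans s≢p s≢q q≢p F G = record
    { target = target G
    ; flips  = flips-trans s≢p s≢q q≢p (flips F) (flips G)
    ; path   = path F ++ᴾ path G
    ; cost≡  = trans (cost-++ᴾ d (path F) (path G)) (cong₂ _+_ (cost≡ F) (cost≡ G))
    }

  flip-pair-path : (A : Subset n) {r r′ : Fin n} (b : Bool) → r ≢ r′ →
                   lookup A r ≡ b → lookup A r′ ≡ b → FlipPath A r r′ (d r r′)
  flip-pair-path A {r} {r′} b r≢r′ Ar Ar′ = record
    { target = flip-pair A r r′
    ; flips  = F
    ; path   = [] ▸ (r , r′ , flips⇒edge b r≢r′ Ar Ar′ F)
    ; cost≡  = ℚₚ.+-identityˡ (d r r′)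
    }
    where
    F : Flips A (flip-pair A r r′) r r′
    F = flip-pair-flips A r≢r′

  -- Take first whichever of the transitions {p, s}, {s, q} has both its requests on the same side of A.
  flip-pair-path-via : (A : Subset n) {p s q : Fin n} → s ≢ p → s ≢ q → lookup A q ≡ not (lookup A p) →
                       FlipPath A p q (d p s + d s q)
  flip-pair-path-via A {p} {s} {q} s≢p s≢q Aq with lookup A s ≟ᵇ lookup A p
  ... | yes As≡Ap = flipPath-trans s≢p s≢q q≢p first second
    where
    q≢p : q ≢ p
    q≢p = lookup≡not⇒≢ {S = A} Aq
    first : FlipPath A p s (d p s)
    first = flip-pair-path A (lookup A p) (s≢p ∘ sym) refl As≡Ap
    second : FlipPath (target first) s q (d s q)
    second = flip-pair-path (target first) (not (lookup A p)) s≢q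
               (flipped-pair (flips first) refl As≡Ap (inj₂ refl))
               (trans (kept (flips first) q≢p (s≢q ∘ sym)) Aq)
  ... | no As≢Ap =
    subst (FlipPath A p q) (ℚₚ.+-comm (d s q) (d p s))
          (flipPath-swap (flipPath-trans s≢q s≢p (q≢p ∘ sym) (flipPath-swap first) (flipPath-swap second)))
    where
    q≢p : q ≢ p
    q≢p = lookup≡not⇒≢ {S = A} Aq
    As≡Aq : lookup A s ≡ lookup A q
    As≡Aq = trans (¬-not As≢Ap) (sym Aq)
    first : FlipPath A s q (d s q)
    first = flip-pair-path A (lookup A q) s≢q As≡Aq refl
    second : FlipPath (target first) p s (d p s)
    second = flip-pair-path (target first) (lookup A p) (s≢p ∘ sym)
               (kept (flips first) (s≢p ∘ sym) (q≢p ∘ sym))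
               (trans (flipped-pair (flips first) As≡Aq refl (inj₁ refl))
                      (trans (cong not Aq) (not-involutive _)))

  piece-path : {A B : Subset n} (π : Piece n) → ValidPiece A B π → end₁ π ≢ end₂ π →
               FlipPath A (end₁ π) (end₂ π) (weight d (pieceEdges π))
  piece-path {A} (single p q) (inj₁ ((p∈A , _) , (q∈A , _))) p≢q =
    subst (FlipPath A p q) (sym (ℚₚ.+-identityʳ _))
          (flip-pair-path A true p≢q ([]=⇒lookup p∈A) ([]=⇒lookup q∈A))
  piece-path {A} (single p q) (inj₂ ((_ , p∉A) , (_ , q∉A))) p≢q =
    subst (FlipPath A p q) (sym (ℚₚ.+-identityʳ _))
          (flip-pair-path A false p≢q (∉⇒lookup≡false p∉A) (∉⇒lookup≡false q∉A))
  piece-path {A} (double p s q) (s≢p , s≢q , inj₁ ((p∈A , _) , (_ , q∉A))) _ =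
    subst (FlipPath A p q) (cong (d p s +_) (sym (ℚₚ.+-identityʳ _)))
          (flip-pair-path-via A s≢p s≢q (trans (∉⇒lookup≡false q∉A) (cong not (sym ([]=⇒lookup p∈A)))))
  piece-path {A} (double p s q) (s≢p , s≢q , inj₂ ((_ , p∉A) , (q∈A , _))) _ =
    subst (FlipPath A p q) (cong (d p s +_) (sym (ℚₚ.+-identityʳ _)))
          (flip-pair-path-via A s≢p s≢q (trans ([]=⇒lookup q∈A) (cong not (sym (∉⇒lookup≡false p∉A)))))

  canonical-path : {A B : Subset n} {D : List (Piece n)} → Canonical A B D →
                   Σ (Path A B) λ P → cost d P ≡ weight d (edges D)
  canonical-path {A} {D = []} C = subst (Path A) (canonical-[]⇒≡ C) [] , cost-subst d (canonical-[]⇒≡ C) []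
  canonical-path {A} {B} {π ∷ D} C = path first ++ᴾ proj₁ rest , (begin
    cost d (path first ++ᴾ proj₁ rest)                   ≡⟨ cost-++ᴾ d (path first) (proj₁ rest) ⟩
    cost d (path first) + cost d (proj₁ rest)            ≡⟨ cong₂ _+_ (cost≡ first) (proj₂ rest) ⟩
    weight d (pieceEdges π) + weight d (edges D)         ≡⟨ weight-++ d (pieceEdges π) (edges D) ⟨
    weight d (edges (π ∷ D))                             ∎)
    where
    open ≡-Reasoning
    first : FlipPath A (end₁ π) (end₂ π) (weight d (pieceEdges π))
    first = piece-path π (valid C (here refl)) (canonical-distinct-ends C (here refl))
    rest : Σ (Path (target first) B) λ P → cost d P ≡ weight d (edges D)
    rest = canonical-path {D = D} (canonical-remove [] π D C (flips first))

  -- Without the piece (p, q), a canonical (A, B)-decomposition is a canonical (A, B ∪ {p, q})-decomposition.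
  canonical-detour : {A B : Subset n} {D : List (Piece n)} {p q : Fin n} →
                     Canonical A B D → single p q ∈ₗ D → p ∈ A ∖ B → q ∈ A ∖ B →
                     Σ (Path A (B ∪ ⁅ p ⁆ ∪ ⁅ q ⁆)) λ R → d p q + cost d R ≡ weight d (edges D)
  canonical-detour {A} {B} {p = p} {q} C pq∈D (_ , p∉B) (_ , q∉B) with ∈-∃++ pq∈D
  ... | D₁ , D₂ , refl = reverseᴾ (proj₁ back) , (begin
    d p q + cost d (reverseᴾ (proj₁ back))       ≡⟨ cong (d p q +_) (trans (cost-reverseᴾ d (proj₁ back)) (proj₂ back)) ⟩
    d p q + w                                    ≡⟨ cong (_+ w) (ℚₚ.+-identityʳ (d p q)) ⟨
    weight d (pieceEdges (single p q)) + w       ≡⟨ weight-edges-++-∷ d D₁ (single p q) D₂ ⟨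
    weight d (edges (D₁ ++ single p q ∷ D₂))     ∎)
    where
    open ≡-Reasoning
    w : ℚ
    w = weight d (edges (D₁ ++ D₂))
    back : Σ (Path (B ∪ ⁅ p ⁆ ∪ ⁅ q ⁆) A) λ P → cost d P ≡ weight d (edges (D₁ ++ D₂))
    back = canonical-path (canonical-remove D₁ (single p q) D₂ (canonical-sym C) (∪-pair-flips p∉B q∉B))

  sensibleStep-amortised : (∀ x y → d x y ≡ d y x) → {A B B′ : Subset n} {c′ : ℚ} →
                       SensibleStep d A B B′ → IsDist d B B′ c′ →
                       (χ : Path A B) → Σ (Path A B′) λ ψ → c′ + cost d ψ ≤ℚ cost d χ
  sensibleStep-amortised d-sym {c′ = c′} (inj₁ (_ , refl)) (_ , c′-min) χ = χ , (begin
    c′ + cost d χ   ≤⟨ ℚₚ.+-monoˡ-≤ (cost d χ) (c′-min []) ⟩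
    0ℚ + cost d χ   ≡⟨ ℚₚ.+-identityˡ (cost d χ) ⟩
    cost d χ        ∎)
    where open ℚₚ.≤-Reasoning
  sensibleStep-amortised d-sym {B = B} {c′ = c′}
    (inj₂ (_ , P , P-min , D , decomposition , diff≋ , p , q , p∈ , q∈ , pq∈D , refl)) (_ , c′-min) χ =
    proj₁ detour , (begin
    c′ + cost d (proj₁ detour)      ≤⟨ ℚₚ.+-monoˡ-≤ (cost d (proj₁ detour)) c′≤dpq ⟩
    d p q + cost d (proj₁ detour)   ≡⟨ proj₂ detour ⟩
    weight d (edges D)              ≡⟨ ≋⇒weight≡ d d-sym (diff P) (edges D) diff≋ ⟨
    weight d (diff P)               ≡⟨ cost≡weight-diff d P ⟨
    cost d P                        ≤⟨ P-min χ ⟩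
    cost d χ                        ∎)
    where
    open ℚₚ.≤-Reasoning
    C = isCanonicalDecomp⇒canonical decomposition
    detour = canonical-detour C pq∈D p∈ q∈
    c′≤dpq : c′ ≤ℚ d p q
    c′≤dpq = ℚₚ.≤-trans (c′-min ([] ▸ (p , q , add-pq))) (ℚₚ.≤-reflexive (ℚₚ.+-identityˡ (d p q)))
      where
      add-pq : Edge B (B ∪ ⁅ p ⁆ ∪ ⁅ q ⁆) p q
      add-pq = canonical-distinct-ends C pq∈D , inj₁ (proj₂ p∈ , proj₂ q∈ , refl)

+-accumulate-≤ : {s t a b w w′ : ℚ} → s + w ≤ℚ t → a + w′ ≤ℚ b + w → (s + a) + w′ ≤ℚ t + b
+-accumulate-≤ {s} {t} {a} {b} {w} {w′} s+w≤t a+w′≤b+w = begin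
  (s + a) + w′  ≡⟨ ℚₚ.+-assoc s a w′ ⟩
  s + (a + w′)  ≤⟨ ℚₚ.+-monoʳ-≤ s a+w′≤b+w ⟩
  s + (b + w)   ≡⟨ cong (s +_) (ℚₚ.+-comm b w) ⟩
  s + (w + b)   ≡⟨ ℚₚ.+-assoc s w b ⟨
  (s + w) + b   ≤⟨ ℚₚ.+-monoˡ-≤ b s+w≤t ⟩
  t + b         ∎
  where open ℚₚ.≤-Reasoning

p≤p+q : {p q : ℚ} → 0ℚ ≤ℚ q → p ≤ℚ p + q
p≤p+q {p} 0≤q = ℚₚ.≤-trans (ℚₚ.≤-reflexive (sym (ℚₚ.+-identityʳ p))) (ℚₚ.+-monoʳ-≤ p 0≤q)

module _ {n : ℕ} (d : Fin n → Fin n → ℚ) (d-sym : ∀ x y → d x y ≡ d y x)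
         {L : ℕ} {S S′ : ℕ → Subset n} {c c′ : ℕ → ℚ} where

  sensibleRun-potential : S 0 ≡ S′ 0 →
    (∀ i → suc i ≤ L → SensibleStep d (S (suc i)) (S′ i) (S′ (suc i))) →
    (∀ i → suc i ≤ L → IsDist d (S i) (S (suc i)) (c (suc i))) →
    (∀ i → suc i ≤ L → IsDist d (S′ i) (S′ (suc i)) (c′ (suc i))) →
    ∀ k → k ≤ L → Σ (Path (S k) (S′ k)) λ ψ → sum1 c′ k + cost d ψ ≤ℚ sum1 c k
  sensibleRun-potential S₀≡S′₀ steps dist dist′ zero _ =
    subst (Path (S 0)) S₀≡S′₀ [] , ℚₚ.≤-reflexive (trans (ℚₚ.+-identityˡ _) (cost-subst d S₀≡S′₀ []))
  sensibleRun-potential S₀≡S′₀ steps dist dist′ (suc k) k<L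
    with sensibleRun-potential S₀≡S′₀ steps dist dist′ k (ℕₚ.<⇒≤ k<L) | proj₁ (dist k k<L)
  ... | ψ , ψ-bound | Q , Q-cost
    with sensibleStep-amortised d d-sym (steps k k<L) (dist′ k k<L) (reverseᴾ Q ++ᴾ ψ)
  ... | ψ′ , ψ′-bound =
    ψ′ , +-accumulate-≤ {s = sum1 c′ k} {a = c′ (suc k)} ψ-bound (ℚₚ.≤-trans ψ′-bound (ℚₚ.≤-reflexive χ-cost))
    where
    χ-cost : cost d (reverseᴾ Q ++ᴾ ψ) ≡ c (suc k) + cost d ψ
    χ-cost = trans (cost-++ᴾ d (reverseᴾ Q) ψ) (cong (_+ cost d ψ) (trans (cost-reverseᴾ d Q) Q-cost))

lemma19 : (n : ℕ) (d : Fin n → Fin n → ℚ) → IsMetric d →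
    (L : ℕ) (S S' : ℕ → Subset n) →
    IsSchedule L S → IsSensibleRun d L S S' →
    (c c' : ℕ → ℚ) →
    (∀ i → suc i ≤ L → IsDist d (S i) (S (suc i)) (c (suc i))) →
    (∀ i → suc i ≤ L → IsDist d (S' i) (S' (suc i)) (c' (suc i))) →
    sum1 c' L ≤ℚ sum1 c L
lemma19 n d metric L S S′ (S₀≡∅ , _ , _) (S′₀≡∅ , steps) c c′ dist dist′
  with sensibleRun-potential d (IsMetric.symm metric) (trans S₀≡∅ (sym S′₀≡∅)) steps dist dist′ L ℕₚ.≤-refl
... | ψ , bound = ℚₚ.≤-trans (p≤p+q (cost-nonneg d (IsMetric.nonneg metric) ψ)) bound
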